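{- Let $a,b,c\in Ag$ be pairwise distinct agents. Then for every $\varphi\in\mathrm{Fm}_{\mathsf S}$: (1) $\vdash_{\mathsf S}K_cS_{a,b}\varphi\to K_c\varphi$; (2) $\vdash_{\mathsf S}S_{a,b}\varphi\to I_a\neg K_bS_{c,b}\varphi$; (3) $\vdash_{\mathsf S}S_{a,b}\varphi\to[B_a(K_c\varphi\to K_b\varphi)\land I_a(K_c\varphi\to K_b\varphi)\leftrightarrow S_{a,c}\varphi]$; (4) $\vdash_{\mathsf S}S_{a,b}\varphi\land I_aK_c\varphi\to I_a\neg(K_c\varphi\to K_b\varphi)$; (5) $\vdash_{\mathsf S}S_{a,b}\varphi\land K_aS_{c,b}\varphi\to(I_aS_{c,b}\varphi\leftrightarrow S_{a,b}(S_{c,b}\varphi))$; moreover, (6) there exists $\varphi$ with $\not\vdash_{\mathsf S}S_{a,b}\varphi\land K_aS_{c,b}\varphi\to S_{a,b}(S_{c,b}\varphi)$, and (7) there exists $\varphi$ with $\not\vdash_{\mathsf S}S_{a,b}(S_{c,b}\varphi)\to S_{a,b}\varphi$.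
   Context: Let $Ag$ be a non-empty finite set of agents and $Var$ a countably infinite set of propositional variables. The formulas $\mathrm{Fm}_{\mathsf S}$ are generated by $\varphi::=p\mid\neg\varphi\mid\varphi\land\varphi\mid I_a\varphi\mid K_a\varphi\mid B_a\varphi$ ($p\in Var$, $a\in Ag$), with $\lor,\to,\leftrightarrow$ classical abbreviations. The logic $\mathsf S$ ($\vdash_{\mathsf S}\varphi$ means $\varphi$ is derivable) has as axioms: all classical tautologies; for each $a$ and $\star\in\{K_a,B_a,I_a\}$, $\star(\varphi\to\psi)\to(\star\varphi\to\star\psi)$; $K_a\varphi\to\varphi$; $K_a\varphi\to K_aK_a\varphi$; $B_a\varphi\to\neg B_a\neg\varphi$; $K_a\varphi\to B_a\varphi$; $B_a\varphi\to K_aB_a\varphi$; $I_a\varphi\to\neg I_a\neg\varphi$; $I_a\varphi\to K_aI_a\varphi$; $I_a\varphi\to I_aK_a\varphi$; $I_a\varphi\to I_aI_a\varphi$; rules: modus ponens and necessitation for each $K_a,B_a,I_a$. For agents $x,y$, $S_{x,y}\varphi:=K_x\varphi\land B_x\neg K_y\varphi\land I_x(\varphi\land\neg K_y\varphi)$. -}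

module Defs where

open import Data.Nat using (ℕ; suc)
open import Data.Fin using (Fin)
open import Data.Bool using (Bool; not; _∧_)
open import Relation.Binary.PropositionalEquality using (_≡_)
open import Relation.Nullary using (¬_)
open import Data.Product using (_×_)

module Logic (n : ℕ) where

  Ag : Set
  Ag = Fin (suc n)

  Var : Set
  Var = ℕ

  infixr 6 _∧'_
  infixr 4 _⇒_
  infix 3 _⇔_

  data Fm : Set where
    var  : Var → Fm
    ¬'_  : Fm → Fm
    _∧'_ : Fm → Fm → Fm
    I    : Ag → Fm → Fm
    K    : Ag → Fm → Fm
    B    : Ag → Fm → Fm

  _∨'_ : Fm → Fm → Fm
  φ ∨' ψ = ¬' (¬' φ ∧' ¬' ψ)

  _⇒_ : Fm → Fm → Fm
  φ ⇒ ψ = ¬' (φ ∧' ¬' ψ)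

  _⇔_ : Fm → Fm → Fm
  φ ⇔ ψ = (φ ⇒ ψ) ∧' (ψ ⇒ φ)

  -- Classical tautologies: formulas true under every Boolean valuation of
  -- all formulas that respects ¬ and ∧ (modal formulas act as atoms).
  record Valuation : Set where
    field
      val   : Fm → Bool
      val-¬ : ∀ φ → val (¬' φ) ≡ not (val φ)
      val-∧ : ∀ φ ψ → val (φ ∧' ψ) ≡ val φ ∧ val ψ
  open Valuation public

  Tautology : Fm → Set
  Tautology φ = (v : Valuation) → val v φ ≡ Data.Bool.true

  data ⊢_ : Fm → Set where
    taut   : ∀ {φ} → Tautology φ → ⊢ φ
    K-dist : ∀ a φ ψ → ⊢ (K a (φ ⇒ ψ) ⇒ (K a φ ⇒ K a ψ))
    B-dist : ∀ a φ ψ → ⊢ (B a (φ ⇒ ψ) ⇒ (B a φ ⇒ B a ψ))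
    I-dist : ∀ a φ ψ → ⊢ (I a (φ ⇒ ψ) ⇒ (I a φ ⇒ I a ψ))
    K-T    : ∀ a φ → ⊢ (K a φ ⇒ φ)
    K-4    : ∀ a φ → ⊢ (K a φ ⇒ K a (K a φ))
    B-D    : ∀ a φ → ⊢ (B a φ ⇒ ¬' B a (¬' φ))
    KB     : ∀ a φ → ⊢ (K a φ ⇒ B a φ)
    BKB    : ∀ a φ → ⊢ (B a φ ⇒ K a (B a φ))
    I-D    : ∀ a φ → ⊢ (I a φ ⇒ ¬' I a (¬' φ))
    IKI    : ∀ a φ → ⊢ (I a φ ⇒ K a (I a φ))
    IIK    : ∀ a φ → ⊢ (I a φ ⇒ I a (K a φ))
    I-4    : ∀ a φ → ⊢ (I a φ ⇒ I a (I a φ))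
    mp     : ∀ {φ ψ} → ⊢ (φ ⇒ ψ) → ⊢ φ → ⊢ ψ
    nec-K  : ∀ a {φ} → ⊢ φ → ⊢ K a φ
    nec-B  : ∀ a {φ} → ⊢ φ → ⊢ B a φ
    nec-I  : ∀ a {φ} → ⊢ φ → ⊢ I a φ

  S : Ag → Ag → Fm → Fm
  S x y φ = K x φ ∧' (B x (¬' K y φ) ∧' I x (φ ∧' ¬' K y φ))

-- Items (1)–(5) hold for arbitrary agents and are propositional consequences of the
-- normality of K, B and I together with S x y φ ⇒ φ (from K x φ ⇒ φ) and its
-- consequence ¬ K y φ ⇒ ¬ K y (S x y φ).  Items (6) and (7) fail at a world of finite
-- Kripke models whose frame conditions validate all axioms of S.  Since renaming agents
-- preserves derivability, collapsing any three distinct agents onto the three agents of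
-- those models transports the refutations.
module Submission where

open import Defs
open import Data.Nat using (ℕ; zero; suc)
open import Data.Fin using (Fin; zero; suc)
open import Data.Fin.Properties using (_≟_; all?; any?)
open import Data.Vec using (Vec; []; _∷_; lookup; map)
open import Data.Vec.Properties using (lookup-map)
open import Data.Bool using (Bool; true; false; not; _∧_; T; if_then_else_)
open import Data.Bool.Properties using (T-≡; T-∧)
open import Data.Product using (_×_; ∃; _,_; proj₁; proj₂)
open import Function using (_∘_; Equivalence)
open import Relation.Nullary using (¬_; Dec; does)
open import Relation.Nullary.Decidable
  using (T?; _→-dec_; _×-dec_; map′; isYes; from-yes; toWitness; fromWitness; dec-true; dec-false)
open import Relation.Binary.PropositionalEquality using (_≡_; _≢_; refl; sym; trans; cong; cong₂)

infix 9 ~_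
infixr 7 _&_
infixr 5 _⊃_

data Schema (k : ℕ) : Set where
  atom : Fin k → Schema k
  ~_   : Schema k → Schema k
  _&_  : Schema k → Schema k → Schema k

_⊃_ : ∀ {k} → Schema k → Schema k → Schema k
s ⊃ t = ~ (s & ~ t)

P : ∀ {k} → Schema (suc k)
P = atom zero

Q : ∀ {k} → Schema (suc (suc k))
Q = atom (suc zero)

R : ∀ {k} → Schema (suc (suc (suc k)))
R = atom (suc (suc zero))

evaluate : ∀ {k} → Schema k → Vec Bool k → Bool
evaluate (atom i) bs = lookup bs i
evaluate (~ s)    bs = not (evaluate s bs)
evaluate (s & t)  bs = evaluate s bs ∧ evaluate t bs

∀-assignment : ∀ k → (Vec Bool k → Bool) → Bool
∀-assignment zero    f = f []
∀-assignment (suc k) f = ∀-assignment k (f ∘ (true ∷_)) ∧ ∀-assignment k (f ∘ (false ∷_))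

∀-assignment-sound : ∀ k f → T (∀-assignment k f) → ∀ bs → T (f bs)
∀-assignment-sound zero    f t [] = t
∀-assignment-sound (suc k) f t (true ∷ bs) =
  ∀-assignment-sound k (f ∘ (true ∷_)) (proj₁ (Equivalence.to T-∧ t)) bs
∀-assignment-sound (suc k) f t (false ∷ bs) =
  ∀-assignment-sound k (f ∘ (false ∷_)) (proj₂ (Equivalence.to T-∧ t)) bs

valid : ∀ {k} → Schema k → Bool
valid {k} s = ∀-assignment k (evaluate s)

module Derivations (n : ℕ) where
  open Logic n

  ⟦_⟧ : ∀ {k} → Schema k → Vec Fm k → Fm
  ⟦ atom i ⟧ ρ = lookup ρ i
  ⟦ ~ s ⟧    ρ = ¬' ⟦ s ⟧ ρ
  ⟦ s & t ⟧  ρ = ⟦ s ⟧ ρ ∧' ⟦ t ⟧ ρ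

  val-⟦⟧ : ∀ {k} (v : Valuation) (s : Schema k) (ρ : Vec Fm k) →
           val v (⟦ s ⟧ ρ) ≡ evaluate s (map (val v) ρ)
  val-⟦⟧ v (atom i) ρ = sym (lookup-map i (val v) ρ)
  val-⟦⟧ v (~ s)    ρ = trans (val-¬ v _) (cong not (val-⟦⟧ v s ρ))
  val-⟦⟧ v (s & t)  ρ = trans (val-∧ v _ _) (cong₂ _∧_ (val-⟦⟧ v s ρ) (val-⟦⟧ v t ρ))

  tautology : ∀ {k} (s : Schema k) {_ : T (valid s)} (ρ : Vec Fm k) → ⊢ ⟦ s ⟧ ρ
  tautology {k} s {t} ρ = taut λ v →
    trans (val-⟦⟧ v s ρ) (Equivalence.to T-≡ (∀-assignment-sound k (evaluate s) t (map (val v) ρ)))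

  private
    variable
      X Y Z : Fm

  infixr 5 _⨾_

  _⨾_ : ⊢ (X ⇒ Y) → ⊢ (Y ⇒ Z) → ⊢ (X ⇒ Z)
  _⨾_ {X} {Y} {Z} f g = mp (mp (tautology ((P ⊃ Q) ⊃ (Q ⊃ R) ⊃ P ⊃ R) (X ∷ Y ∷ Z ∷ [])) f) g

  ⟨_,_⟩ : ⊢ (X ⇒ Y) → ⊢ (X ⇒ Z) → ⊢ (X ⇒ Y ∧' Z)
  ⟨_,_⟩ {X} {Y} {Z} f g = mp (mp (tautology ((P ⊃ Q) ⊃ (P ⊃ R) ⊃ P ⊃ Q & R) (X ∷ Y ∷ Z ∷ [])) f) g

  π₁ : ⊢ (X ∧' Y ⇒ X)
  π₁ {X} {Y} = tautology (P & Q ⊃ P) (X ∷ Y ∷ [])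

  π₂ : ⊢ (X ∧' Y ⇒ Y)
  π₂ {X} {Y} = tautology (P & Q ⊃ Q) (X ∷ Y ∷ [])

  curry : ⊢ (X ∧' Y ⇒ Z) → ⊢ (X ⇒ Y ⇒ Z)
  curry {X} {Y} {Z} = mp (tautology ((P & Q ⊃ R) ⊃ P ⊃ Q ⊃ R) (X ∷ Y ∷ Z ∷ []))

  uncurry : ⊢ (X ⇒ Y ⇒ Z) → ⊢ (X ∧' Y ⇒ Z)
  uncurry {X} {Y} {Z} = mp (tautology ((P ⊃ Q ⊃ R) ⊃ P & Q ⊃ R) (X ∷ Y ∷ Z ∷ []))

  contraposition : ⊢ (X ⇒ Y) → ⊢ (¬' Y ⇒ ¬' X)
  contraposition {X} {Y} = mp (tautology ((P ⊃ Q) ⊃ ~ Q ⊃ ~ P) (X ∷ Y ∷ []))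

  modus-tollens : ⊢ ((X ⇒ Y) ∧' ¬' Y ⇒ ¬' X)
  modus-tollens {X} {Y} = tautology ((P ⊃ Q) & ~ Q ⊃ ~ P) (X ∷ Y ∷ [])

  vacuous-⇒ : ⊢ (¬' X ⇒ X ⇒ Y)
  vacuous-⇒ {X} {Y} = tautology (~ P ⊃ P ⊃ Q) (X ∷ Y ∷ [])

  ¬¬-intro : ⊢ (X ⇒ ¬' ¬' X)
  ¬¬-intro {X} = tautology (P ⊃ ~ ~ P) (X ∷ [])

  record Normal (□ : Fm → Fm) : Set where
    field
      nec  : ⊢ X → ⊢ □ X
      dist : ∀ X Y → ⊢ (□ (X ⇒ Y) ⇒ □ X ⇒ □ Y)
  open Normal

  K-normal : ∀ x → Normal (K x)
  K-normal x = record { nec = nec-K x ; dist = K-dist x }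

  B-normal : ∀ x → Normal (B x)
  B-normal x = record { nec = nec-B x ; dist = B-dist x }

  I-normal : ∀ x → Normal (I x)
  I-normal x = record { nec = nec-I x ; dist = I-dist x }

  mono : ∀ {□} → Normal □ → ⊢ (X ⇒ Y) → ⊢ (□ X ⇒ □ Y)
  mono {X} {Y} N f = mp (dist N X Y) (nec N f)

  mono₂ : ∀ {□} → Normal □ → ⊢ (X ∧' Y ⇒ Z) → ⊢ (□ X ∧' □ Y ⇒ □ Z)
  mono₂ {X} {Y} {Z} N f = uncurry (mono N (curry f) ⨾ dist N Y Z)

  private
    variable
      x y z : Ag
      φ : Fm

  S-K : ⊢ (S x y φ ⇒ K x φ)
  S-K = π₁

  S-B : ⊢ (S x y φ ⇒ B x (¬' K y φ))
  S-B = π₂ ⨾ π₁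

  S-I : ⊢ (S x y φ ⇒ I x (φ ∧' ¬' K y φ))
  S-I = π₂ ⨾ π₂

  S-veridical : ⊢ (S x y φ ⇒ φ)
  S-veridical {x} {φ = φ} = S-K ⨾ K-T x φ

  ¬K-secret : ⊢ (¬' K y φ ⇒ ¬' K y (S x y φ))
  ¬K-secret {y} = contraposition (mono (K-normal y) S-veridical)

  KS⇒K : ⊢ (K z (S x y φ) ⇒ K z φ)
  KS⇒K {z} = mono (K-normal z) S-veridical

  S⇒I¬KS : ⊢ (S x y φ ⇒ I x (¬' K y (S z y φ)))
  S⇒I¬KS {x} = S-I ⨾ mono (I-normal x) (π₂ ⨾ ¬K-secret)

  S⇒BI⇔S : ⊢ (S x y φ ⇒ (B x (K z φ ⇒ K y φ) ∧' I x (K z φ ⇒ K y φ) ⇔ S x z φ))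
  S⇒BI⇔S {x} {y} {φ} {z} = ⟨ curry forward , curry backward ⟩
    where
    forward : ⊢ (S x y φ ∧' (B x (K z φ ⇒ K y φ) ∧' I x (K z φ ⇒ K y φ)) ⇒ S x z φ)
    forward = ⟨ π₁ ⨾ S-K
              , ⟨ ⟨ π₂ ⨾ π₁ , π₁ ⨾ S-B ⟩ ⨾ mono₂ (B-normal x) modus-tollens
                , ⟨ π₂ ⨾ π₂ , π₁ ⨾ S-I ⟩
                  ⨾ mono₂ (I-normal x) ⟨ π₂ ⨾ π₁ , ⟨ π₁ , π₂ ⨾ π₂ ⟩ ⨾ modus-tollens ⟩
                ⟩
              ⟩
    backward : ⊢ (S x y φ ∧' S x z φ ⇒ B x (K z φ ⇒ K y φ) ∧' I x (K z φ ⇒ K y φ))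
    backward = π₂ ⨾ ⟨ S-B ⨾ mono (B-normal x) vacuous-⇒ , S-I ⨾ mono (I-normal x) (π₂ ⨾ vacuous-⇒) ⟩

  S∧IK⇒I¬⇒ : ⊢ (S x y φ ∧' I x (K z φ) ⇒ I x (¬' (K z φ ⇒ K y φ)))
  S∧IK⇒I¬⇒ {x} = ⟨ π₂ , π₁ ⨾ S-I ⟩ ⨾ mono₂ (I-normal x) (⟨ π₁ , π₂ ⨾ π₂ ⟩ ⨾ ¬¬-intro)

  S∧KS⇒IS⇔SS : ⊢ (S x y φ ∧' K x (S z y φ) ⇒ (I x (S z y φ) ⇔ S x y (S z y φ)))
  S∧KS⇒IS⇔SS {x} {y} {φ} {z} = ⟨ curry forward , curry backward ⟩
    where
    forward : ⊢ ((S x y φ ∧' K x (S z y φ)) ∧' I x (S z y φ) ⇒ S x y (S z y φ))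
    forward = ⟨ π₁ ⨾ π₂
              , ⟨ π₁ ⨾ π₁ ⨾ S-B ⨾ mono (B-normal x) ¬K-secret
                , ⟨ π₂ , π₁ ⨾ π₁ ⨾ S-I ⟩ ⨾ mono₂ (I-normal x) ⟨ π₁ , π₂ ⨾ π₂ ⨾ ¬K-secret ⟩
                ⟩
              ⟩
    backward : ⊢ ((S x y φ ∧' K x (S z y φ)) ∧' S x y (S z y φ) ⇒ I x (S z y φ))
    backward = π₂ ⨾ S-I ⨾ mono (I-normal x) π₁

BRel : ℕ → Set
BRel m = Fin m → Fin m → Bool

infixr 5 _⇒ᵇ_

_⇒ᵇ_ : Bool → Bool → Bool
x ⇒ᵇ y = not (x ∧ not y)

⇒ᵇ-intro : ∀ x y → (T x → T y) → T (x ⇒ᵇ y)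
⇒ᵇ-intro false _     _ = _
⇒ᵇ-intro true  true  _ = _
⇒ᵇ-intro true  false h = h _

⇒ᵇ-elim : ∀ x y → T (x ⇒ᵇ y) → T x → T y
⇒ᵇ-elim true true _ _ = _

not-intro : ∀ x → ¬ T x → T (not x)
not-intro false _ = _
not-intro true  h = h _

not-elim : ∀ x → T (not x) → ¬ T x
not-elim false _ ()

module _ {m : ℕ} where

  infix 4 _⊆_ _⨾_⊆_

  [_] : BRel m → (Fin m → Bool) → Fin m → Bool
  [ R ] f u = isYes (all? λ v → T? (R u v) →-dec T? (f v))

  []-intro : ∀ R f u → (∀ v → T (R u v) → T (f v)) → T ([ R ] f u)
  []-intro R f u = fromWitness {a? = all? λ v → T? (R u v) →-dec T? (f v)}

  []-elim : ∀ R f u → T ([ R ] f u) → ∀ v → T (R u v) → T (f v)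
  []-elim R f u = toWitness {a? = all? λ v → T? (R u v) →-dec T? (f v)}

  Reflexive Serial : BRel m → Set
  Reflexive R = ∀ u → T (R u u)
  Serial    R = ∀ u → ∃ λ v → T (R u v)

  _⊆_ : BRel m → BRel m → Set
  R ⊆ R′ = ∀ u v → T (R u v) → T (R′ u v)

  _⨾_⊆_ : BRel m → BRel m → BRel m → Set
  R ⨾ R′ ⊆ R″ = ∀ u v w → T (R u v) → T (R′ v w) → T (R″ u w)

  reflexive? : ∀ R → Dec (Reflexive R)
  reflexive? R = all? λ u → T? (R u u)

  serial? : ∀ R → Dec (Serial R)
  serial? R = all? λ u → any? λ v → T? (R u v)

  ⊆? : ∀ R R′ → Dec (R ⊆ R′)
  ⊆? R R′ = all? λ u → all? λ v → T? (R u v) →-dec T? (R′ u v)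

  ⨾⊆? : ∀ R R′ R″ → Dec (R ⨾ R′ ⊆ R″)
  ⨾⊆? R R′ R″ = all? λ u → all? λ v → all? λ w → T? (R u v) →-dec T? (R′ v w) →-dec T? (R″ u w)

  []-nec : ∀ R {f u} → (∀ v → T (f v)) → T ([ R ] f u)
  []-nec R {f} {u} h = []-intro R f u λ v _ → h v

  []-dist : ∀ R {f g u} → T ([ R ] (λ v → f v ⇒ᵇ g v) u ⇒ᵇ [ R ] f u ⇒ᵇ [ R ] g u)
  []-dist R {f} {g} {u} = ⇒ᵇ-intro ([ R ] (λ v → f v ⇒ᵇ g v) u) ([ R ] f u ⇒ᵇ [ R ] g u) λ □f⇒g →
    ⇒ᵇ-intro ([ R ] f u) ([ R ] g u) λ □f → []-intro R g u λ v uRv →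
      ⇒ᵇ-elim (f v) (g v) ([]-elim R _ u □f⇒g v uRv) ([]-elim R f u □f v uRv)

  module _ {R : BRel m} {f : Fin m → Bool} {u : Fin m} where

    []-reflexive : Reflexive R → T ([ R ] f u ⇒ᵇ f u)
    []-reflexive refl-R = ⇒ᵇ-intro ([ R ] f u) (f u) λ □f → []-elim R f u □f u (refl-R u)

    []-serial : Serial R → T ([ R ] f u ⇒ᵇ not ([ R ] (not ∘ f) u))
    []-serial serial-R = ⇒ᵇ-intro ([ R ] f u) (not ([ R ] (not ∘ f) u)) λ □f →
      not-intro ([ R ] (not ∘ f) u) λ □¬f →
        let (v , uRv) = serial-R u
        in  not-elim (f v) ([]-elim R (not ∘ f) u □¬f v uRv) ([]-elim R f u □f v uRv)

    []-⊆ : ∀ {R′} → R′ ⊆ R → T ([ R ] f u ⇒ᵇ [ R′ ] f u)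
    []-⊆ {R′} R′⊆R = ⇒ᵇ-intro ([ R ] f u) ([ R′ ] f u) λ □f →
      []-intro R′ f u λ v uR′v → []-elim R f u □f v (R′⊆R u v uR′v)

  []-⨾ : ∀ {R R′ R″ f u} → R ⨾ R′ ⊆ R″ → T ([ R″ ] f u ⇒ᵇ [ R ] ([ R′ ] f) u)
  []-⨾ {R} {R′} {R″} {f} {u} R⨾R′⊆R″ = ⇒ᵇ-intro ([ R″ ] f u) ([ R ] ([ R′ ] f) u) λ □f →
    []-intro R ([ R′ ] f) u λ v uRv → []-intro R′ f v λ w vR′w →
      []-elim R″ f u □f w (R⨾R′⊆R″ u v w uRv vR′w)

module Semantics (n : ℕ) where
  open Logic n

  record Model (m : ℕ) : Set where
    field
      Rᴷ Rᴮ Rᴵ : Ag → BRel m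
      V        : Var → Fin m → Bool

  module _ {m : ℕ} (M : Model m) where
    open Model M

    sat : Fm → Fin m → Bool
    sat (var p)    = V p
    sat (¬' φ)   w = not (sat φ w)
    sat (φ ∧' ψ) w = sat φ w ∧ sat ψ w
    sat (I x φ)    = [ Rᴵ x ] (sat φ)
    sat (K x φ)    = [ Rᴷ x ] (sat φ)
    sat (B x φ)    = [ Rᴮ x ] (sat φ)

    valuation-at : Fin m → Valuation
    valuation-at w = record { val = λ φ → sat φ w ; val-¬ = λ _ → refl ; val-∧ = λ _ _ → refl }

    record IsSFrame : Set where
      constructor mkIsSFrame
      field
        K-reflexive  : ∀ x → Reflexive (Rᴷ x)
        K-transitive : ∀ x → Rᴷ x ⨾ Rᴷ x ⊆ Rᴷ x
        B-serial     : ∀ x → Serial (Rᴮ x)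
        B⊆K          : ∀ x → Rᴮ x ⊆ Rᴷ x
        K⨾B⊆B        : ∀ x → Rᴷ x ⨾ Rᴮ x ⊆ Rᴮ x
        I-serial     : ∀ x → Serial (Rᴵ x)
        K⨾I⊆I        : ∀ x → Rᴷ x ⨾ Rᴵ x ⊆ Rᴵ x
        I⨾K⊆I        : ∀ x → Rᴵ x ⨾ Rᴷ x ⊆ Rᴵ x
        I-transitive : ∀ x → Rᴵ x ⨾ Rᴵ x ⊆ Rᴵ x

    isSFrame? : Dec IsSFrame
    isSFrame? =
      map′ (λ (c₁ , c₂ , c₃ , c₄ , c₅ , c₆ , c₇ , c₈ , c₉) → mkIsSFrame c₁ c₂ c₃ c₄ c₅ c₆ c₇ c₈ c₉)
           (λ (mkIsSFrame c₁ c₂ c₃ c₄ c₅ c₆ c₇ c₈ c₉) → c₁ , c₂ , c₃ , c₄ , c₅ , c₆ , c₇ , c₈ , c₉)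
           (   all? (λ x → reflexive? (Rᴷ x))
           ×-dec all? (λ x → ⨾⊆? (Rᴷ x) (Rᴷ x) (Rᴷ x))
           ×-dec all? (λ x → serial? (Rᴮ x))
           ×-dec all? (λ x → ⊆? (Rᴮ x) (Rᴷ x))
           ×-dec all? (λ x → ⨾⊆? (Rᴷ x) (Rᴮ x) (Rᴮ x))
           ×-dec all? (λ x → serial? (Rᴵ x))
           ×-dec all? (λ x → ⨾⊆? (Rᴷ x) (Rᴵ x) (Rᴵ x))
           ×-dec all? (λ x → ⨾⊆? (Rᴵ x) (Rᴷ x) (Rᴵ x))
           ×-dec all? (λ x → ⨾⊆? (Rᴵ x) (Rᴵ x) (Rᴵ x)))

    module _ (frame : IsSFrame) where
      open IsSFrame frame

      sound : ∀ {φ} → ⊢ φ → ∀ w → T (sat φ w)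
      sound (taut t)         w = Equivalence.from T-≡ (t (valuation-at w))
      sound (K-dist x φ ψ)   w = []-dist (Rᴷ x)
      sound (B-dist x φ ψ)   w = []-dist (Rᴮ x)
      sound (I-dist x φ ψ)   w = []-dist (Rᴵ x)
      sound (K-T x φ)        w = []-reflexive (K-reflexive x)
      sound (K-4 x φ)        w = []-⨾ (K-transitive x)
      sound (B-D x φ)        w = []-serial (B-serial x)
      sound (KB x φ)         w = []-⊆ (B⊆K x)
      sound (BKB x φ)        w = []-⨾ (K⨾B⊆B x)
      sound (I-D x φ)        w = []-serial (I-serial x)
      sound (IKI x φ)        w = []-⨾ (K⨾I⊆I x)
      sound (IIK x φ)        w = []-⨾ (I⨾K⊆I x)
      sound (I-4 x φ)        w = []-⨾ (I-transitive x)
      sound (mp {φ} {ψ} h k) w = ⇒ᵇ-elim (sat φ w) (sat ψ w) (sound h w) (sound k w)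
      sound (nec-K x h)      w = []-nec (Rᴷ x) λ v → sound h v
      sound (nec-B x h)      w = []-nec (Rᴮ x) λ v → sound h v
      sound (nec-I x h)      w = []-nec (Rᴵ x) λ v → sound h v

      refuted⇒unprovable : ∀ {φ} w → ¬ T (sat φ w) → ¬ ⊢ φ
      refuted⇒unprovable w ¬φ ⊢φ = ¬φ (sound ⊢φ w)

pattern a₀ = zero
pattern b₀ = suc zero
pattern c₀ = suc (suc zero)

pattern w₀ = zero
pattern w₁ = suc zero
pattern w₂ = suc (suc zero)
pattern w₃ = suc (suc (suc zero))

module Countermodels where
  open Logic 2
  open Semantics 2

  _==_ : ∀ {m} → Fin m → Fin m → Bool
  u == v = does (u ≟ v)

  p : Fm
  p = var 0

  true-except-at-w₂ : ∀ {m} → Var → Fin m → Bool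
  true-except-at-w₂ _ w₂ = false
  true-except-at-w₂ _ _  = true

  K₆ : Ag → BRel 3
  K₆ b₀ _  w₂ = true
  K₆ c₀ w₁ w₂ = true
  K₆ _  u  v  = u == v

  I₆ : Ag → BRel 3
  I₆ a₀ w₀ v = v == w₁
  I₆ x  u  v = K₆ x u v

  M₆ : Model 3
  M₆ = record { Rᴷ = K₆ ; Rᴮ = K₆ ; Rᴵ = I₆ ; V = true-except-at-w₂ }

  M₆-isSFrame : IsSFrame M₆
  M₆-isSFrame = from-yes (isSFrame? M₆)

  -- Stated up to equality of agents so that it applies to renamed formulas, whose
  -- agents are only propositionally equal to a₀, b₀, c₀.
  -- At w₀, a's knowledge and belief reach only w₀, where S c b p holds, but a's
  -- intention reaches only w₁, from where c sees the ¬p-world w₂.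
  S∧KS⇏SS : ∀ {x y z} → x ≡ a₀ → y ≡ b₀ → z ≡ c₀ → ¬ ⊢ (S x y p ∧' K x (S z y p) ⇒ S x y (S z y p))
  S∧KS⇏SS refl refl refl = refuted⇒unprovable M₆ M₆-isSFrame w₀ λ ()

  K₇ : Ag → BRel 4
  K₇ b₀ w₀ w₃ = true
  K₇ b₀ w₁ w₂ = true
  K₇ c₀ w₀ w₁ = true
  K₇ _  u  v  = u == v

  B₇ : Ag → BRel 4
  B₇ c₀ w₀ v = v == w₁
  B₇ x  u  v = K₇ x u v

  M₇ : Model 4
  M₇ = record { Rᴷ = K₇ ; Rᴮ = B₇ ; Rᴵ = B₇ ; V = true-except-at-w₂ }

  M₇-isSFrame : IsSFrame M₇
  M₇-isSFrame = from-yes (isSFrame? M₇)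

  -- At w₀, b reaches only p-worlds, so S a b p fails; S c b p holds at w₀ (c's belief
  -- world w₁ reaches w₂ for b) but not at w₃, which b reaches.
  SS⇏S : ∀ {x y z} → x ≡ a₀ → y ≡ b₀ → z ≡ c₀ → ¬ ⊢ (S x y (S z y p) ⇒ S x y p)
  SS⇏S refl refl refl = refuted⇒unprovable M₇ M₇-isSFrame w₀ λ ()

module Renaming {n m : ℕ} (f : Logic.Ag n → Logic.Ag m) where
  private
    module Src = Logic n
    module Tgt = Logic m

  rename : Src.Fm → Tgt.Fm
  rename (Src.var p)  = Tgt.var p
  rename (Src.¬' φ)   = Tgt.¬' rename φ
  rename (φ Src.∧' ψ) = rename φ Tgt.∧' rename ψ
  rename (Src.I x φ)  = Tgt.I (f x) (rename φ)
  rename (Src.K x φ)  = Tgt.K (f x) (rename φ)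
  rename (Src.B x φ)  = Tgt.B (f x) (rename φ)

  rename-valuation : Tgt.Valuation → Src.Valuation
  rename-valuation v = record
    { val   = Tgt.val v ∘ rename
    ; val-¬ = Tgt.val-¬ v ∘ rename
    ; val-∧ = λ φ ψ → Tgt.val-∧ v (rename φ) (rename ψ)
    }

  rename-⊢ : ∀ {φ} → Src.⊢ φ → Tgt.⊢ rename φ
  rename-⊢ (Src.taut t)         = Tgt.taut (t ∘ rename-valuation)
  rename-⊢ (Src.K-dist x φ ψ)   = Tgt.K-dist (f x) (rename φ) (rename ψ)
  rename-⊢ (Src.B-dist x φ ψ)   = Tgt.B-dist (f x) (rename φ) (rename ψ)
  rename-⊢ (Src.I-dist x φ ψ)   = Tgt.I-dist (f x) (rename φ) (rename ψ)
  rename-⊢ (Src.K-T x φ)        = Tgt.K-T (f x) (rename φ)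
  rename-⊢ (Src.K-4 x φ)        = Tgt.K-4 (f x) (rename φ)
  rename-⊢ (Src.B-D x φ)        = Tgt.B-D (f x) (rename φ)
  rename-⊢ (Src.KB x φ)         = Tgt.KB (f x) (rename φ)
  rename-⊢ (Src.BKB x φ)        = Tgt.BKB (f x) (rename φ)
  rename-⊢ (Src.I-D x φ)        = Tgt.I-D (f x) (rename φ)
  rename-⊢ (Src.IKI x φ)        = Tgt.IKI (f x) (rename φ)
  rename-⊢ (Src.IIK x φ)        = Tgt.IIK (f x) (rename φ)
  rename-⊢ (Src.I-4 x φ)        = Tgt.I-4 (f x) (rename φ)
  rename-⊢ (Src.mp h k)         = Tgt.mp (rename-⊢ h) (rename-⊢ k)
  rename-⊢ (Src.nec-K x h)      = Tgt.nec-K (f x) (rename-⊢ h)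
  rename-⊢ (Src.nec-B x h)      = Tgt.nec-B (f x) (rename-⊢ h)
  rename-⊢ (Src.nec-I x h)      = Tgt.nec-I (f x) (rename-⊢ h)

module ThreeAgents {n : ℕ} {a b c : Logic.Ag n} (a≢b : a ≢ b) (a≢c : a ≢ c) (b≢c : b ≢ c) where
  open Logic n
  open Renaming

  collapse : Ag → Logic.Ag 2
  collapse x = if does (x ≟ a) then a₀ else if does (x ≟ b) then b₀ else c₀

  collapse-a : collapse a ≡ a₀
  collapse-a rewrite dec-true (a ≟ a) refl = refl

  collapse-b : collapse b ≡ b₀
  collapse-b rewrite dec-false (b ≟ a) (a≢b ∘ sym) | dec-true (b ≟ b) refl = refl

  collapse-c : collapse c ≡ c₀
  collapse-c rewrite dec-false (c ≟ a) (a≢c ∘ sym) | dec-false (c ≟ b) (b≢c ∘ sym) = refl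

  S∧KS⇏SS : ¬ ⊢ (S a b (var 0) ∧' K a (S c b (var 0)) ⇒ S a b (S c b (var 0)))
  S∧KS⇏SS = Countermodels.S∧KS⇏SS collapse-a collapse-b collapse-c ∘ rename-⊢ collapse

  SS⇏S : ¬ ⊢ (S a b (S c b (var 0)) ⇒ S a b (var 0))
  SS⇏S = Countermodels.SS⇏S collapse-a collapse-b collapse-c ∘ rename-⊢ collapse

proposition16 : (n : ℕ) → let open Logic n in
    (a b c : Ag) → ¬ a ≡ b → ¬ a ≡ c → ¬ b ≡ c →
    ((φ : Fm) →
        (⊢ (K c (S a b φ) ⇒ K c φ))
      × (⊢ (S a b φ ⇒ I a (¬' K b (S c b φ))))
      × (⊢ (S a b φ ⇒ ((B a (K c φ ⇒ K b φ) ∧' I a (K c φ ⇒ K b φ)) ⇔ S a c φ)))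
      × (⊢ ((S a b φ ∧' I a (K c φ)) ⇒ I a (¬' (K c φ ⇒ K b φ))))
      × (⊢ ((S a b φ ∧' K a (S c b φ)) ⇒ (I a (S c b φ) ⇔ S a b (S c b φ)))))
    × (∃ λ φ → ¬ (⊢ ((S a b φ ∧' K a (S c b φ)) ⇒ S a b (S c b φ))))
    × (∃ λ φ → ¬ (⊢ (S a b (S c b φ) ⇒ S a b φ)))
proposition16 n a b c a≢b a≢c b≢c =
    (λ φ → KS⇒K , S⇒I¬KS , S⇒BI⇔S , S∧IK⇒I¬⇒ , S∧KS⇒IS⇔SS)
  , (var 0 , S∧KS⇏SS)
  , (var 0 , SS⇏S)
  where
  open Logic n
  open Derivations n
  open ThreeAgents a≢b a≢c b≢c
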